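{- Let $G$ and $H$ be incidence hypergraphs and let $[G,H]_{L}$ and $\mathrm{cev}_{H}^{G}:G\blacksquare[G,H]_{L}\to H$ be as defined in the context. Then for every incidence hypergraph $K$ and every incidence hypergraph homomorphism $\phi:G\blacksquare K\to H$ there is a unique incidence hypergraph homomorphism $\hat{\phi}:K\to[G,H]_{L}$ such that $\mathrm{cev}_{H}^{G}\circ\left(G\blacksquare\hat{\phi}\right)=\phi$.
   Context: An incidence hypergraph $G$ consists of sets $\check V(G)$ (vertices), $\check E(G)$ (edges), $I(G)$ (incidences) and functions $\varsigma_G:I(G)\to\check V(G)$, $\omega_G:I(G)\to\check E(G)$. A homomorphism $\phi:G\to H$ is a triple of functions $\check V(\phi),\check E(\phi),I(\phi)$ with $\varsigma_H\circ I(\phi)=\check V(\phi)\circ\varsigma_G$ and $\omega_H\circ I(\phi)=\check E(\phi)\circ\omega_G$; composition is componentwise. $\mathfrak{R}$ is this category and $\mathfrak{R}(G,H)$ the set of homomorphisms. The incidence dual is $G^{\#}:=(\check E(G),\check V(G),I(G),\omega_G,\varsigma_G)$, i.e. $\check V(G^\#)=\check E(G)$, $\check E(G^\#)=\check V(G)$, $I(G^\#)=I(G)$, $\varsigma_{G^\#}=\omega_G$, $\omega_{G^\#}=\varsigma_G$; on morphisms $\phi^\#=(\check E(\phi),\check V(\phi),I(\phi))$. Laplacian product: $\check V(G\blacksquare H)=(\{1\}\times\check V(G)\times\check V(H))\cup(\{4\}\times\check E(G)\times\check E(H))$, $\check E(G\blacksquare H)=(\{2\}\times\check E(G)\times\check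 V(H))\cup(\{3\}\times\check V(G)\times\check E(H))$, $I(G\blacksquare H)=(\{1\}\times I(G)\times\check V(H))\cup(\{2\}\times I(G)\times\check E(H))\cup(\{3\}\times\check E(G)\times I(H))\cup(\{4\}\times\check V(G)\times I(H))$, with $\varsigma(1,x,y)=(1,\varsigma_G(x),y)$, $\varsigma(2,x,y)=(4,\omega_G(x),y)$, $\varsigma(3,x,y)=(4,x,\omega_H(y))$, $\varsigma(4,x,y)=(1,x,\varsigma_H(y))$, and $\omega(1,x,y)=(2,\omega_G(x),y)$, $\omega(2,x,y)=(3,\varsigma_G(x),y)$, $\omega(3,x,y)=(2,x,\varsigma_H(y))$, $\omega(4,x,y)=(3,x,\omega_H(y))$. For $\phi:G_1\to G_2$, $\psi:H_1\to H_2$, $\phi\blacksquare\psi$ acts by $(1,x,y)\mapsto(1,\check V\phi(x),\check V\psi(y))$, $(4,x,y)\mapsto(4,\check E\phi(x),\check E\psi(y))$ on vertices; $(2,x,y)\mapsto(2,\check E\phi(x),\check V\psi(y))$, $(3,x,y)\mapsto(3,\check V\phi(x),\check E\psi(y))$ on edges; and on incidences $(1,x,y)\mapsto(1,I\phi(x),\check V\psi(y))$, $(2,x,y)\mapsto(2,I\phi(x),\check E\psi(y))$, $(3,x,y)\mapsto(3,\check E\phi(x),I\psi(y))$, $(4,x,y)\mapsto(4,\check V\phi(x),I\psi(y))$. Special objects: $\check V^{\diamond}(\{1\})$ has one vertex $1$ and nothing else; $\check E^{\diamond}(\{1\})$ has one edge $1$ and nothing else; $I^{\diamond}(\{1\})$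 has one vertex $1$, one edge $1$, one incidence $1$ joining them. $Y(y):\check V^\diamond(\{1\})\to I^\diamond(\{1\})$ and $Y(z):\check E^\diamond(\{1\})\to I^\diamond(\{1\})$ are the homomorphisms sending the vertex (resp. edge) to the vertex (resp. edge). The isomorphism $\check\rho_G:G\blacksquare\check V^\diamond(\{1\})\to G$ is $(1,v,1)\mapsto v$, $(2,e,1)\mapsto e$, $(1,i,1)\mapsto i$; the isomorphism $\hat\rho_G:G\blacksquare\check E^\diamond(\{1\})\to G^\#$ is $(4,e,1)\mapsto e$ on vertices, $(3,v,1)\mapsto v$ on edges, $(2,i,1)\mapsto i$ on incidences. Laplacian exponential $[G,H]_L$: $\check V[G,H]_L=\mathfrak R(G,H)$, $\check E[G,H]_L=\mathfrak R(G^\#,H)$, $I[G,H]_L=\mathfrak R(G\blacksquare I^\diamond(\{1\}),H)$, $\varsigma(\psi)=\psi\circ(G\blacksquare Y(y))\circ\check\rho_G^{ -1}$, $\omega(\psi)=\psi\circ(G\blacksquare Y(z))\circ\hat\rho_G^{ -1}$. The evaluation $\mathrm{cev}_H^G:G\blacksquare[G,H]_L\to H$ is: $\check V(\mathrm{cev})(n,x,\phi)=\check V(\phi)(x)$, $\check E(\mathrm{cev})(n,x,\phi)=\check E(\phi)(x)$, $I(\mathrm{cev})(n,x,\psi)=I(\psi)(x)$ for $n=1,2$, $I(\psi)(3,x,1)$ for $n=3$, $I(\psi)(4,x,1)$ for $n=4$. -}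

module Defs where

open import Data.Unit using (⊤; tt)
open import Data.Empty using (⊥)
open import Data.Product using (_×_; _,_)
open import Relation.Binary.PropositionalEquality using (_≡_; refl; cong; cong₂)

record Hypergraph : Set₁ where
  field
    V : Set
    E : Set
    I : Set
    ς : I → V
    ω : I → E
open Hypergraph public

record PreHom (G H : Hypergraph) : Set where
  constructor prehom
  field
    Vf : V G → V H
    Ef : E G → E H
    If : I G → I H
open PreHom public

record Hom (G H : Hypergraph) : Set where
  constructor hom
  field
    pre   : PreHom G H
    ς-law : ∀ i → ς H (If pre i) ≡ Vf pre (ς G i)
    ω-law : ∀ i → ω H (If pre i) ≡ Ef pre (ω G i)
open Hom public

_∘ₚ_ : {G H K : Hypergraph} → PreHom H K → PreHom G H → PreHom G K
g ∘ₚ f = prehom (λ x → Vf g (Vf f x)) (λ x → Ef g (Ef f x)) (λ x → If g (If f x))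

idₚ : (G : Hypergraph) → PreHom G G
idₚ G = prehom (λ x → x) (λ x → x) (λ x → x)

_∘ₕ_ : {G H K : Hypergraph} → Hom H K → Hom G H → Hom G K
_∘ₕ_ {G} {H} {K} g f = hom (pre g ∘ₚ pre f)
  (λ i → Relation.Binary.PropositionalEquality.trans (ς-law g (If (pre f) i)) (cong (Vf (pre g)) (ς-law f i)))
  (λ i → Relation.Binary.PropositionalEquality.trans (ω-law g (If (pre f) i)) (cong (Ef (pre g)) (ω-law f i)))

idₕ : (G : Hypergraph) → Hom G G
idₕ G = hom (idₚ G) (λ _ → refl) (λ _ → refl)

_≃ₚ_ : {G H : Hypergraph} → PreHom G H → PreHom G H → Set
f ≃ₚ g = (∀ v → Vf f v ≡ Vf g v) × (∀ e → Ef f e ≡ Ef g e) × (∀ i → If f i ≡ If g i)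

_≃_ : {G H : Hypergraph} → Hom G H → Hom G H → Set
f ≃ g = pre f ≃ₚ pre g

_# : Hypergraph → Hypergraph
G # = record { V = E G ; E = V G ; I = I G ; ς = ω G ; ω = ς G }

data V■ (G H : Hypergraph) : Set where
  v1 : V G → V H → V■ G H
  v4 : E G → E H → V■ G H

data E■ (G H : Hypergraph) : Set where
  e2 : E G → V H → E■ G H
  e3 : V G → E H → E■ G H

data I■ (G H : Hypergraph) : Set where
  i1 : I G → V H → I■ G H
  i2 : I G → E H → I■ G H
  i3 : E G → I H → I■ G H
  i4 : V G → I H → I■ G H

ς■ : (G H : Hypergraph) → I■ G H → V■ G H
ς■ G H (i1 x y) = v1 (ς G x) y
ς■ G H (i2 x y) = v4 (ω G x) y
ς■ G H (i3 x y) = v4 x (ω H y)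
ς■ G H (i4 x y) = v1 x (ς H y)

ω■ : (G H : Hypergraph) → I■ G H → E■ G H
ω■ G H (i1 x y) = e2 (ω G x) y
ω■ G H (i2 x y) = e3 (ς G x) y
ω■ G H (i3 x y) = e2 x (ς H y)
ω■ G H (i4 x y) = e3 x (ω H y)

_■_ : Hypergraph → Hypergraph → Hypergraph
G ■ H = record { V = V■ G H ; E = E■ G H ; I = I■ G H ; ς = ς■ G H ; ω = ω■ G H }

_■ₚ_ : {G₁ G₂ H₁ H₂ : Hypergraph} → PreHom G₁ G₂ → PreHom H₁ H₂ → PreHom (G₁ ■ H₁) (G₂ ■ H₂)
_■ₚ_ {G₁} {G₂} {H₁} {H₂} φ ψ = prehom fV fE fI
  where
  fV : V■ G₁ H₁ → V■ G₂ H₂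
  fV (v1 x y) = v1 (Vf φ x) (Vf ψ y)
  fV (v4 x y) = v4 (Ef φ x) (Ef ψ y)
  fE : E■ G₁ H₁ → E■ G₂ H₂
  fE (e2 x y) = e2 (Ef φ x) (Vf ψ y)
  fE (e3 x y) = e3 (Vf φ x) (Ef ψ y)
  fI : I■ G₁ H₁ → I■ G₂ H₂
  fI (i1 x y) = i1 (If φ x) (Vf ψ y)
  fI (i2 x y) = i2 (If φ x) (Ef ψ y)
  fI (i3 x y) = i3 (Ef φ x) (If ψ y)
  fI (i4 x y) = i4 (Vf φ x) (If ψ y)

_■ₕ_ : {G₁ G₂ H₁ H₂ : Hypergraph} → Hom G₁ G₂ → Hom H₁ H₂ → Hom (G₁ ■ H₁) (G₂ ■ H₂)
_■ₕ_ {G₁} {G₂} {H₁} {H₂} φ ψ = hom (pre φ ■ₚ pre ψ) sl wl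
  where
  sl : ∀ i → ς (G₂ ■ H₂) (If (pre φ ■ₚ pre ψ) i) ≡ Vf (pre φ ■ₚ pre ψ) (ς (G₁ ■ H₁) i)
  sl (i1 x y) = cong (λ z → v1 z (Vf (pre ψ) y)) (ς-law φ x)
  sl (i2 x y) = cong (λ z → v4 z (Ef (pre ψ) y)) (ω-law φ x)
  sl (i3 x y) = cong (λ z → v4 (Ef (pre φ) x) z) (ω-law ψ y)
  sl (i4 x y) = cong (λ z → v1 (Vf (pre φ) x) z) (ς-law ψ y)
  wl : ∀ i → ω (G₂ ■ H₂) (If (pre φ ■ₚ pre ψ) i) ≡ Ef (pre φ ■ₚ pre ψ) (ω (G₁ ■ H₁) i)
  wl (i1 x y) = cong (λ z → e2 z (Vf (pre ψ) y)) (ω-law φ x)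
  wl (i2 x y) = cong (λ z → e3 z (Ef (pre ψ) y)) (ς-law φ x)
  wl (i3 x y) = cong (λ z → e2 (Ef (pre φ) x) z) (ς-law ψ y)
  wl (i4 x y) = cong (λ z → e3 (Vf (pre φ) x) z) (ω-law ψ y)

V◇ : Hypergraph
V◇ = record { V = ⊤ ; E = ⊥ ; I = ⊥ ; ς = λ () ; ω = λ () }

E◇ : Hypergraph
E◇ = record { V = ⊥ ; E = ⊤ ; I = ⊥ ; ς = λ () ; ω = λ () }

I◇ : Hypergraph
I◇ = record { V = ⊤ ; E = ⊤ ; I = ⊤ ; ς = λ _ → tt ; ω = λ _ → tt }

Yy : Hom V◇ I◇
Yy = hom (prehom (λ _ → tt) (λ ()) (λ ())) (λ ()) (λ ())

Yz : Hom E◇ I◇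
Yz = hom (prehom (λ ()) (λ _ → tt) (λ ())) (λ ()) (λ ())

-- inverses of the isomorphisms ρ̌_G : G ■ V◇ → G and ρ̂_G : G ■ E◇ → G #
ρ̌⁻¹ : (G : Hypergraph) → Hom G (G ■ V◇)
ρ̌⁻¹ G = hom (prehom (λ v → v1 v tt) (λ e → e2 e tt) (λ i → i1 i tt)) (λ _ → refl) (λ _ → refl)

ρ̂⁻¹ : (G : Hypergraph) → Hom (G #) (G ■ E◇)
ρ̂⁻¹ G = hom (prehom (λ e → v4 e tt) (λ v → e3 v tt) (λ i → i2 i tt)) (λ _ → refl) (λ _ → refl)

[_,_]L : Hypergraph → Hypergraph → Hypergraph
[ G , H ]L = record
  { V = Hom G H
  ; E = Hom (G #) H
  ; I = Hom (G ■ I◇) H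
  ; ς = λ ψ → ψ ∘ₕ ((idₕ G ■ₕ Yy) ∘ₕ ρ̌⁻¹ G)
  ; ω = λ ψ → ψ ∘ₕ ((idₕ G ■ₕ Yz) ∘ₕ ρ̂⁻¹ G)
  }

cevₚ : (G H : Hypergraph) → PreHom (G ■ [ G , H ]L) H
cevₚ G H = prehom fV fE fI
  where
  fV : V■ G [ G , H ]L → V H
  fV (v1 x φ) = Vf (pre φ) x
  fV (v4 x φ) = Vf (pre φ) x
  fE : E■ G [ G , H ]L → E H
  fE (e2 x φ) = Ef (pre φ) x
  fE (e3 x φ) = Ef (pre φ) x
  fI : I■ G [ G , H ]L → I H
  fI (i1 x ψ) = If (pre ψ) x
  fI (i2 x ψ) = If (pre ψ) x
  fI (i3 x ψ) = If (pre ψ) (i3 x tt)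
  fI (i4 x ψ) = If (pre ψ) (i4 x tt)

cev : (G H : Hypergraph) → Hom (G ■ [ G , H ]L) H
cev G H = hom (cevₚ G H) sl wl
  where
  sl : ∀ i → ς H (If (cevₚ G H) i) ≡ Vf (cevₚ G H) (ς (G ■ [ G , H ]L) i)
  sl (i1 x ψ) = ς-law ψ x
  sl (i2 x ψ) = ς-law ψ x
  sl (i3 x ψ) = ς-law ψ (i3 x tt)
  sl (i4 x ψ) = ς-law ψ (i4 x tt)
  wl : ∀ i → ω H (If (cevₚ G H) i) ≡ Ef (cevₚ G H) (ω (G ■ [ G , H ]L) i)
  wl (i1 x ψ) = ω-law ψ x
  wl (i2 x ψ) = ω-law ψ x
  wl (i3 x ψ) = ω-law ψ (i3 x tt)
  wl (i4 x ψ) = ω-law ψ (i4 x tt)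

-- Homomorphisms K → [G,H]_L.  The vertices/edges/incidences of [G,H]_L are
-- themselves homomorphisms, whose equality (without function extensionality)
-- is taken to be extensional equality _≃_.
record HomL (K G H : Hypergraph) : Set where
  constructor homL
  field
    preL   : PreHom K [ G , H ]L
    ς-lawL : ∀ i → ς [ G , H ]L (If preL i) ≃ Vf preL (ς K i)
    ω-lawL : ∀ i → ω [ G , H ]L (If preL i) ≃ Ef preL (ω K i)
open HomL public

_≃L_ : {K G H : Hypergraph} → HomL K G H → HomL K G H → Set
f ≃L g = (∀ v → Vf (preL f) v ≃ Vf (preL g) v)
       × (∀ e → Ef (preL f) e ≃ Ef (preL g) e)
       × (∀ i → If (preL f) i ≃ If (preL g) i)

module Submission where

open import Defs
open import Data.Product using (Σ; _×_; _,_)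
open import Relation.Binary.PropositionalEquality using (_≡_; refl; trans)

-- The transpose of φ : G ■ K → H sends a vertex k to φ(−, k) : G → H, an edge e to
-- φ(−, e) : G # → H, and an incidence j to the map G ■ I◇ → H that is φ(−, ς j) and
-- φ(−, ω j) on the copies G ■ {vertex} and G ■ {edge} of G and φ on the i3/i4
-- incidences at j. Uniqueness: cev sees the vertex and edge parts and the i3/i4
-- incidences directly, and the homomorphism laws of a map K → [G,H]_L force the rest
-- of the image of j to be the images of ς j and ω j.

module _ (G H : Hypergraph) where

  uncurryₚ : {K : Hypergraph} → HomL K G H → PreHom (G ■ K) H
  uncurryₚ ψ = pre (cev G H) ∘ₚ (idₚ G ■ₚ preL ψ)

  module _ {K : Hypergraph} (φ : Hom (G ■ K) H) where

    curryV : V K → Hom G H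
    curryV k = hom (prehom (λ x → Vf (pre φ) (v1 x k)) (λ e → Ef (pre φ) (e2 e k))
                           (λ i → If (pre φ) (i1 i k)))
                   (λ i → ς-law φ (i1 i k)) (λ i → ω-law φ (i1 i k))

    curryE : E K → Hom (G #) H
    curryE e = hom (prehom (λ x → Vf (pre φ) (v4 x e)) (λ v → Ef (pre φ) (e3 v e))
                           (λ i → If (pre φ) (i2 i e)))
                   (λ i → ς-law φ (i2 i e)) (λ i → ω-law φ (i2 i e))

    curryI : I K → Hom (G ■ I◇) H
    curryI j = hom (prehom fV fE fI) ς-lawI ω-lawI
      where
      fV : V■ G I◇ → V H
      fV (v1 x _) = Vf (pre φ) (v1 x (ς K j))
      fV (v4 x _) = Vf (pre φ) (v4 x (ω K j))
      fE : E■ G I◇ → E H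
      fE (e2 x _) = Ef (pre φ) (e2 x (ς K j))
      fE (e3 x _) = Ef (pre φ) (e3 x (ω K j))
      fI : I■ G I◇ → I H
      fI (i1 x _) = If (pre φ) (i1 x (ς K j))
      fI (i2 x _) = If (pre φ) (i2 x (ω K j))
      fI (i3 x _) = If (pre φ) (i3 x j)
      fI (i4 x _) = If (pre φ) (i4 x j)
      ς-lawI : ∀ i → ς H (fI i) ≡ fV (ς (G ■ I◇) i)
      ς-lawI (i1 x _) = ς-law φ (i1 x (ς K j))
      ς-lawI (i2 x _) = ς-law φ (i2 x (ω K j))
      ς-lawI (i3 x _) = ς-law φ (i3 x j)
      ς-lawI (i4 x _) = ς-law φ (i4 x j)
      ω-lawI : ∀ i → ω H (fI i) ≡ fE (ω (G ■ I◇) i)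
      ω-lawI (i1 x _) = ω-law φ (i1 x (ς K j))
      ω-lawI (i2 x _) = ω-law φ (i2 x (ω K j))
      ω-lawI (i3 x _) = ω-law φ (i3 x j)
      ω-lawI (i4 x _) = ω-law φ (i4 x j)

    curry : HomL K G H
    curry = homL (prehom curryV curryE curryI)
                 (λ _ → (λ _ → refl) , (λ _ → refl) , (λ _ → refl))
                 (λ _ → (λ _ → refl) , (λ _ → refl) , (λ _ → refl))

    uncurry-curry : uncurryₚ curry ≃ₚ pre φ
    uncurry-curry = onV , onE , onI
      where
      onV : ∀ v → Vf (uncurryₚ curry) v ≡ Vf (pre φ) v
      onV (v1 _ _) = refl
      onV (v4 _ _) = refl
      onE : ∀ e → Ef (uncurryₚ curry) e ≡ Ef (pre φ) e
      onE (e2 _ _) = refl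
      onE (e3 _ _) = refl
      onI : ∀ i → If (uncurryₚ curry) i ≡ If (pre φ) i
      onI (i1 _ _) = refl
      onI (i2 _ _) = refl
      onI (i3 _ _) = refl
      onI (i4 _ _) = refl

    curry-unique : (ψ : HomL K G H) → uncurryₚ ψ ≃ₚ pre φ → ψ ≃L curry
    curry-unique ψ (onV , onE , onI) = atV , atE , atI
      where
      atV : ∀ k → Vf (preL ψ) k ≃ curryV k
      atV k = (λ x → onV (v1 x k)) , (λ e → onE (e2 e k)) , (λ i → onI (i1 i k))

      atE : ∀ e → Ef (preL ψ) e ≃ curryE e
      atE e = (λ x → onV (v4 x e)) , (λ v → onE (e3 v e)) , (λ i → onI (i2 i e))

      atI : ∀ j → If (preL ψ) j ≃ curryI j
      atI j = agree (ς-lawL ψ j) (ω-lawL ψ j)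
        where
        agree : ς [ G , H ]L (If (preL ψ) j) ≃ Vf (preL ψ) (ς K j)
              → ω [ G , H ]L (If (preL ψ) j) ≃ Ef (preL ψ) (ω K j)
              → If (preL ψ) j ≃ curryI j
        agree (sV , sE , sI) (wV , wE , wI) = gV , gE , gI
          where
          gV : ∀ v → Vf (pre (If (preL ψ) j)) v ≡ Vf (pre (curryI j)) v
          gV (v1 x _) = trans (sV x) (onV (v1 x (ς K j)))
          gV (v4 x _) = trans (wV x) (onV (v4 x (ω K j)))
          gE : ∀ e → Ef (pre (If (preL ψ) j)) e ≡ Ef (pre (curryI j)) e
          gE (e2 x _) = trans (sE x) (onE (e2 x (ς K j)))
          gE (e3 x _) = trans (wE x) (onE (e3 x (ω K j)))
          gI : ∀ i → If (pre (If (preL ψ) j)) i ≡ If (pre (curryI j)) i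
          gI (i1 x _) = trans (sI x) (onI (i1 x (ς K j)))
          gI (i2 x _) = trans (wI x) (onI (i2 x (ω K j)))
          gI (i3 x _) = onI (i3 x j)
          gI (i4 x _) = onI (i4 x j)

mainTheorem1 : (G H K : Hypergraph) (φ : Hom (G ■ K) H) →
    Σ (HomL K G H) (λ φ̂ →
      ((pre (cev G H) ∘ₚ (idₚ G ■ₚ preL φ̂)) ≃ₚ pre φ)
      × ((ψ : HomL K G H) → (pre (cev G H) ∘ₚ (idₚ G ■ₚ preL ψ)) ≃ₚ pre φ → ψ ≃L φ̂))
mainTheorem1 G H K φ = curry G H φ , uncurry-curry G H φ , curry-unique G H φ
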